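{- For every instance $I$ of the $\mathsf{DTSPMS}$, $I$ and its associated $\mathsf{TSP}$ instance $I_\Sigma$ satisfy $$OPT(I_\Sigma)\succeq \tfrac12\left(WOR(I)+OPT(I)\right),$$ where $\succeq$ means $\ge$ if the goal is to maximize and $\le$ if the goal is to minimize.
   Context: An instance of the $\mathsf{DTSPMS}$ is $I=(n,k,c,d_P,d_D,\mathrm{opt})$ with $V=\{0,\dots,n\}$ (depot $0$), capacity $c\ge\lceil n/k\rceil$ for each of $k$ rows, distances $d_P,d_D:V\times V\to\mathbb{Q}_{\ge0}$ with zero diagonal, goal $\mathrm{opt}\in\{\min,\max\}$. A tour is a directed Hamiltonian cycle $(0,i_1,\dots,i_n,0)$ on $V$; $T^-$ is its reverse; $d(T)$ its total distance. A feasible solution is a loading plan $\mathcal{P}$ (orders $1,\dots,n$ distributed into $k$ sequences of length at most $c$) with tours $T_P,T_D$ such that whenever $i$ is loaded below $j$ in the same row, $T_P$ visits $i$ before $j$ and $T_D$ visits $j$ before $i$; its value is $d_P(T_P)+d_D(T_D)$. $OPT(I)$ is the best and $WOR(I)$ the worst feasible value with respect to $\mathrm{opt}$. $d_\Sigma(i,j)=d_P(i,j)+d_D(j,i)$; $I_\Sigma$ is the $\mathsf{TSP}$ instance on $V$ with distance $d_\Sigma$ and goal $\mathrm{opt}$, and $OPT(I_\Sigma)$ its optimal tour value. -}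

module Defs where

open import Data.Nat using (ℕ; zero; suc; _≤_; _<_; _*_; NonZero)
open import Data.Fin using (Fin; zero; suc; toℕ)
open import Data.Fin.Permutation using (Permutation′; _⟨$⟩ʳ_; _⟨$⟩ˡ_)
open import Data.List using (List; []; _∷_; _++_; [_]; map; allFin; length; concat; lookup)
open import Data.List.Relation.Binary.Permutation.Propositional using (_↭_)
open import Data.Vec using (Vec; toList)
import Data.Vec as Vec
open import Data.Rational using (ℚ; 0ℚ; ½) renaming (_≤_ to _≤ℚ_; _+_ to _+ℚ_; _*_ to _*ℚ_)
open import Data.Product using (Σ; ∃-syntax; _×_)
open import Relation.Binary.PropositionalEquality using (_≡_)

data Goal : Set where
  minimize maximize : Goal

_⪰[_]_ : ℚ → Goal → ℚ → Set
a ⪰[ minimize ] b = a ≤ℚ b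
a ⪰[ maximize ] b = b ≤ℚ a

-- Vertices: Fin (suc n); depot = zero; order i ∈ {1..n} is vertex suc o for o : Fin n.
Vertex : ℕ → Set
Vertex n = Fin (suc n)

record Distance (n : ℕ) : Set where
  field
    d       : Vertex n → Vertex n → ℚ
    nonneg  : ∀ i j → 0ℚ ≤ℚ d i j
    zeroDiag : ∀ i → d i i ≡ 0ℚ
open Distance public

-- An instance I = (n, k, c, d_P, d_D, opt) of the DTSPMS.
-- c ≥ ⌈n/k⌉ (with k ≥ 1) is expressed as n ≤ k * c.
record Instance : Set where
  field
    n    : ℕ
    k    : ℕ
    c    : ℕ
    .{{k≢0}} : NonZero k
    cap  : n ≤ k * c
    dP   : Distance n
    dD   : Distance n
    goal : Goal
open Instance public

-- A tour (0, i₁, …, iₙ, 0): a permutation giving, for each position p, the order visited there.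
Tour : ℕ → Set
Tour n = Permutation′ n

tourSeq : ∀ {n} → Tour n → List (Vertex n)
tourSeq {n} σ = zero ∷ (map (λ p → suc (σ ⟨$⟩ʳ p)) (allFin n) ++ [ zero ])

pathCost : ∀ {A : Set} → (A → A → ℚ) → List A → ℚ
pathCost d [] = 0ℚ
pathCost d (x ∷ []) = 0ℚ
pathCost d (x ∷ y ∷ l) = d x y +ℚ pathCost d (y ∷ l)

tourCost : ∀ {n} → (Vertex n → Vertex n → ℚ) → Tour n → ℚ
tourCost d T = pathCost d (tourSeq T)

visitPos : ∀ {n} → Tour n → Fin n → ℕ
visitPos T o = toℕ (T ⟨$⟩ˡ o)

VisitsBefore : ∀ {n} → Tour n → Fin n → Fin n → Set
VisitsBefore T i j = visitPos T i < visitPos T j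

-- A loading plan: k rows (listed bottom to top), each of length ≤ c,
-- together containing every order exactly once.
record LoadingPlan (n k c : ℕ) : Set where
  field
    rows     : Vec (List (Fin n)) k
    rowCap   : ∀ r → length (Vec.lookup rows r) ≤ c
    distrib  : concat (toList rows) ↭ allFin n
open LoadingPlan public

LoadedBelow : ∀ {n k c} → LoadingPlan n k c → Fin n → Fin n → Set
LoadedBelow {k = k} P i j =
  ∃[ r ] (let row = Vec.lookup (rows P) r in
    ∃[ a ] ∃[ b ] (toℕ a < toℕ b × lookup row a ≡ i × lookup row b ≡ j))

record Solution (I : Instance) : Set where
  field
    plan : LoadingPlan (n I) (k I) (c I)
    TP   : Tour (n I)
    TD   : Tour (n I)
    lifo : ∀ i j → LoadedBelow plan i j → VisitsBefore TP i j × VisitsBefore TD j i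
open Solution public

value : {I : Instance} → Solution I → ℚ
value {I} s = tourCost (d (dP I)) (TP s) +ℚ tourCost (d (dD I)) (TD s)

IsOPT : Instance → ℚ → Set
IsOPT I v = Σ (Solution I) (λ s → value s ≡ v) × (∀ (s : Solution I) → v ⪰[ goal I ] value s)

IsWOR : Instance → ℚ → Set
IsWOR I v = Σ (Solution I) (λ s → value s ≡ v) × (∀ (s : Solution I) → value s ⪰[ goal I ] v)

dΣ : (I : Instance) → Vertex (n I) → Vertex (n I) → ℚ
dΣ I i j = d (dP I) i j +ℚ d (dD I) j i

IsOPTΣ : Instance → ℚ → Set
IsOPTΣ I v = Σ (Tour (n I)) (λ T → tourCost (dΣ I) T ≡ v)
           × (∀ (T : Tour (n I)) → v ⪰[ goal I ] tourCost (dΣ I) T)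

half : ℚ → ℚ
half x = ½ *ℚ x

-- Exchanging and reversing the two tours of a feasible solution (P, T_P, T_D)
-- gives another feasible solution (P, T_D⁻, T_P⁻), since reversal turns every
-- LIFO precedence of T_D into the one required of the pickup tour and vice versa.
-- As d_Σ(T) = d_P(T) + d_D(T⁻), the two TSP tours T_P and T_D⁻ have d_Σ-lengths
-- summing to the value of (P, T_P, T_D) plus the value of (P, T_D⁻, T_P⁻).
-- Starting from an optimal solution, OPT(I_Σ) is at least as good as the mean of
-- these two lengths, i.e. of OPT(I) and a feasible value, itself no worse than WOR(I).
module Submission where

open import Defs
open import Data.Rational using (ℚ) renaming (_+_ to _+ℚ_)

open import Data.Nat using (suc; s≤s) renaming (_<_ to _<ℕ_)
open import Data.Nat.Properties using (∸-monoʳ-<)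
open import Data.Fin using (Fin; zero; toℕ; opposite; inject₁; fromℕ)
open import Data.Fin.Properties using (opposite-prop; toℕ<n)
open import Data.Fin.Permutation using (_⟨$⟩ʳ_; _∘ₚ_) renaming (reverse to reverseₚ)
open import Data.List using ([]; _∷_; [_]; _∷ʳ_; map; allFin; tabulate; reverse)
open import Data.List.Properties using (map-tabulate; unfold-reverse; reverse-++)
open import Data.Rational using (½) renaming (_≤_ to _≤ℚ_; _*_ to _*ℚ_)
import Data.Rational.Properties as ℚ
open import Algebra.Bundles using (CommutativeMonoid)
open import Algebra.Properties.CommutativeSemigroup (CommutativeMonoid.commutativeSemigroup ℚ.+-0-commutativeMonoid)
  using (interchange)
open import Data.Product using (_,_; proj₁; proj₂)
open import Function using (_∘_; flip; id)
open import Relation.Binary.Bundles using (Preorder)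
open import Relation.Binary.Structures using (IsPreorder)
import Relation.Binary.Reasoning.Preorder as PreorderReasoning
open import Relation.Binary.PropositionalEquality using (_≡_; refl; sym; trans; cong; cong₂; isEquivalence; module ≡-Reasoning)

opposite-antimono-< : ∀ {n} {i j : Fin n} → toℕ i <ℕ toℕ j → toℕ (opposite j) <ℕ toℕ (opposite i)
opposite-antimono-< {i = i} {j} i<j
  rewrite opposite-prop i | opposite-prop j = ∸-monoʳ-< (s≤s i<j) (toℕ<n j)

tabulate-∷ʳ : ∀ {A : Set} {n} (f : Fin (suc n) → A) →
              tabulate f ≡ tabulate (f ∘ inject₁) ∷ʳ f (fromℕ n)
tabulate-∷ʳ {n = 0} f = refl
tabulate-∷ʳ {n = suc n}  f = cong (f zero ∷_) (tabulate-∷ʳ (f ∘ Data.Fin.suc))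

reverse-tabulate : ∀ {A : Set} {n} (f : Fin n → A) → reverse (tabulate f) ≡ tabulate (f ∘ opposite)
reverse-tabulate {n = 0} f = refl
reverse-tabulate {n = suc n}  f = begin
  reverse (tabulate f)                              ≡⟨ cong reverse (tabulate-∷ʳ f) ⟩
  reverse (tabulate (f ∘ inject₁) ∷ʳ f (fromℕ n))   ≡⟨ reverse-++ (tabulate (f ∘ inject₁)) [ f (fromℕ n) ] ⟩
  f (fromℕ n) ∷ reverse (tabulate (f ∘ inject₁))    ≡⟨ cong (f (fromℕ n) ∷_) (reverse-tabulate (f ∘ inject₁)) ⟩
  f (fromℕ n) ∷ tabulate (f ∘ inject₁ ∘ opposite)   ∎
  where open ≡-Reasoning

reverse-∷-∷ʳ : ∀ {A : Set} (x : A) xs y → reverse (x ∷ xs ∷ʳ y) ≡ y ∷ reverse xs ∷ʳ x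
reverse-∷-∷ʳ x xs y = trans (reverse-++ (x ∷ xs) [ y ]) (cong (y ∷_) (unfold-reverse x xs))

pathCost-∷ʳ : ∀ {A : Set} (d : A → A → ℚ) xs y z →
              pathCost d (xs ∷ʳ y ∷ʳ z) ≡ pathCost d (xs ∷ʳ y) +ℚ d y z
pathCost-∷ʳ d []           y z = trans (ℚ.+-identityʳ (d y z)) (sym (ℚ.+-identityˡ (d y z)))
pathCost-∷ʳ d (x ∷ [])     y z = trans (cong (d x y +ℚ_) (pathCost-∷ʳ d [] y z))
                                       (sym (ℚ.+-assoc (d x y) _ (d y z)))
pathCost-∷ʳ d (x ∷ w ∷ xs) y z = trans (cong (d x w +ℚ_) (pathCost-∷ʳ d (w ∷ xs) y z))
                                       (sym (ℚ.+-assoc (d x w) _ (d y z)))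

pathCost-reverse : ∀ {A : Set} (d : A → A → ℚ) xs → pathCost d (reverse xs) ≡ pathCost (flip d) xs
pathCost-reverse d []           = refl
pathCost-reverse d (x ∷ [])     = refl
pathCost-reverse d (x ∷ y ∷ xs) = begin
  pathCost d (reverse (x ∷ y ∷ xs))           ≡⟨ cong (pathCost d) (unfold-reverse x (y ∷ xs)) ⟩
  pathCost d (reverse (y ∷ xs) ∷ʳ x)          ≡⟨ cong (λ l → pathCost d (l ∷ʳ x)) (unfold-reverse y xs) ⟩
  pathCost d (reverse xs ∷ʳ y ∷ʳ x)           ≡⟨ pathCost-∷ʳ d (reverse xs) y x ⟩
  pathCost d (reverse xs ∷ʳ y) +ℚ d y x       ≡⟨ cong (λ l → pathCost d l +ℚ d y x) (unfold-reverse y xs) ⟨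
  pathCost d (reverse (y ∷ xs)) +ℚ d y x      ≡⟨ cong (_+ℚ d y x) (pathCost-reverse d (y ∷ xs)) ⟩
  pathCost (flip d) (y ∷ xs) +ℚ d y x         ≡⟨ ℚ.+-comm _ (d y x) ⟩
  pathCost (flip d) (x ∷ y ∷ xs)              ∎
  where open ≡-Reasoning

pathCost-+ : ∀ {A : Set} (d e : A → A → ℚ) xs →
             pathCost (λ i j → d i j +ℚ e i j) xs ≡ pathCost d xs +ℚ pathCost e xs
pathCost-+ d e []           = refl
pathCost-+ d e (x ∷ [])     = refl
pathCost-+ d e (x ∷ y ∷ xs) =
  trans (cong (d x y +ℚ e x y +ℚ_) (pathCost-+ d e (y ∷ xs)))
        (interchange (d x y) (e x y) (pathCost d (y ∷ xs)) (pathCost e (y ∷ xs)))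

_⁻ : ∀ {n} → Tour n → Tour n
T ⁻ = reverseₚ ∘ₚ T

tourSeq-⁻ : ∀ {n} (T : Tour n) → tourSeq (T ⁻) ≡ reverse (tourSeq T)
tourSeq-⁻ {n} T = begin
  zero ∷ map (f ∘ opposite) (allFin n) ∷ʳ zero   ≡⟨ cong (λ l → zero ∷ l ∷ʳ zero) orders-reversed ⟩
  zero ∷ reverse (map f (allFin n)) ∷ʳ zero      ≡⟨ reverse-∷-∷ʳ zero (map f (allFin n)) zero ⟨
  reverse (tourSeq T)                            ∎
  where
  open ≡-Reasoning
  f : Fin n → Vertex n
  f p = Data.Fin.suc (T ⟨$⟩ʳ p)
  orders-reversed : map (f ∘ opposite) (allFin n) ≡ reverse (map f (allFin n))
  orders-reversed = begin
    map (f ∘ opposite) (allFin n)  ≡⟨ map-tabulate id (f ∘ opposite) ⟩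
    tabulate (f ∘ opposite)        ≡⟨ reverse-tabulate f ⟨
    reverse (tabulate f)           ≡⟨ cong reverse (map-tabulate id f) ⟨
    reverse (map f (allFin n))     ∎

tourCost-⁻ : ∀ {n} (d : Vertex n → Vertex n → ℚ) T → tourCost d (T ⁻) ≡ tourCost (flip d) T
tourCost-⁻ d T = trans (cong (pathCost d) (tourSeq-⁻ T)) (pathCost-reverse d (tourSeq T))

VisitsBefore-⁻ : ∀ {n} (T : Tour n) {i j} → VisitsBefore T i j → VisitsBefore (T ⁻) j i
VisitsBefore-⁻ T = opposite-antimono-<

reverseSwap : ∀ {I} → Solution I → Solution I
reverseSwap s = record
  { plan = plan s
  ; TP   = TD s ⁻
  ; TD   = TP s ⁻
  ; lifo = λ i j below → VisitsBefore-⁻ (TD s) (proj₂ (lifo s i j below))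
                       , VisitsBefore-⁻ (TP s) (proj₁ (lifo s i j below))
  }

tourCost-dΣ : ∀ I T → tourCost (dΣ I) T ≡ tourCost (d (dP I)) T +ℚ tourCost (d (dD I)) (T ⁻)
tourCost-dΣ I T = trans (pathCost-+ (d (dP I)) (flip (d (dD I))) (tourSeq T))
                        (cong (tourCost (d (dP I)) T +ℚ_) (sym (tourCost-⁻ (d (dD I)) T)))

-- Uses that flip (flip d) is d up to η.
tourCost-dΣ-⁻ : ∀ I T → tourCost (dΣ I) (T ⁻) ≡ tourCost (d (dP I)) (T ⁻) +ℚ tourCost (d (dD I)) T
tourCost-dΣ-⁻ I T = trans (pathCost-+ (d (dP I)) (flip (d (dD I))) (tourSeq (T ⁻)))
                          (cong (tourCost (d (dP I)) (T ⁻) +ℚ_) (tourCost-⁻ (flip (d (dD I))) T))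

tourCost-dΣ-TD⁻+TP : ∀ {I} (s : Solution I) →
  tourCost (dΣ I) (TD s ⁻) +ℚ tourCost (dΣ I) (TP s) ≡ value (reverseSwap s) +ℚ value s
tourCost-dΣ-TD⁻+TP {I} s = begin
  tourCost (dΣ I) (TD s ⁻) +ℚ tourCost (dΣ I) (TP s)
    ≡⟨ cong₂ _+ℚ_ (tourCost-dΣ-⁻ I (TD s)) (tourCost-dΣ I (TP s)) ⟩
  (pTD⁻ +ℚ dTD) +ℚ (pTP +ℚ dTP⁻)   ≡⟨ cong ((pTD⁻ +ℚ dTD) +ℚ_) (ℚ.+-comm pTP dTP⁻) ⟩
  (pTD⁻ +ℚ dTD) +ℚ (dTP⁻ +ℚ pTP)   ≡⟨ interchange pTD⁻ dTD dTP⁻ pTP ⟩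
  (pTD⁻ +ℚ dTP⁻) +ℚ (dTD +ℚ pTP)   ≡⟨ cong ((pTD⁻ +ℚ dTP⁻) +ℚ_) (ℚ.+-comm dTD pTP) ⟩
  (pTD⁻ +ℚ dTP⁻) +ℚ (pTP +ℚ dTD)   ∎
  where
  open ≡-Reasoning
  pTP pTD⁻ dTD dTP⁻ : ℚ
  pTP  = tourCost (d (dP I)) (TP s)
  pTD⁻ = tourCost (d (dP I)) (TD s ⁻)
  dTD  = tourCost (d (dD I)) (TD s)
  dTP⁻ = tourCost (d (dD I)) (TP s ⁻)

⪰-isPreorder : ∀ g → IsPreorder _≡_ (_⪰[ g ]_)
⪰-isPreorder minimize = ℚ.≤-isPreorder
⪰-isPreorder maximize = record
  { isEquivalence = isEquivalence
  ; reflexive     = ℚ.≤-reflexive ∘ sym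
  ; trans         = flip ℚ.≤-trans
  }

⪰-preorder : Goal → Preorder _ _ _
⪰-preorder g = record { isPreorder = ⪰-isPreorder g }

half-mono-≤ : ∀ {x y} → x ≤ℚ y → half x ≤ℚ half y
half-mono-≤ = ℚ.*-monoˡ-≤-nonNeg ½

half-+-mono-⪰ : ∀ g {x x′ y y′} → x ⪰[ g ] x′ → y ⪰[ g ] y′ → half (x +ℚ y) ⪰[ g ] half (x′ +ℚ y′)
half-+-mono-⪰ minimize x≤x′ y≤y′ = half-mono-≤ (ℚ.+-mono-≤ x≤x′ y≤y′)
half-+-mono-⪰ maximize x′≤x y′≤y = half-mono-≤ (ℚ.+-mono-≤ x′≤x y′≤y)

half-+-self : ∀ x → half (x +ℚ x) ≡ x
half-+-self x = begin
  ½ *ℚ (x +ℚ x)        ≡⟨ ℚ.*-distribˡ-+ ½ x x ⟩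
  ½ *ℚ x +ℚ ½ *ℚ x     ≡⟨ ℚ.*-distribʳ-+ x ½ ½ ⟨
  (½ +ℚ ½) *ℚ x        ≡⟨ ℚ.*-identityˡ x ⟩
  x                    ∎
  where open ≡-Reasoning

lemma2 : (I : Instance) (opt wor optΣ : ℚ) → IsOPT I opt → IsWOR I wor → IsOPTΣ I optΣ → optΣ ⪰[ goal I ] half (wor +ℚ opt)
lemma2 I opt wor optΣ ((s , value-s≡opt) , _) (_ , wor-worst) (_ , optΣ-best) = begin
  optΣ                                                    ≡⟨ half-+-self optΣ ⟨
  half (optΣ +ℚ optΣ)                                     ∼⟨ half-+-mono-⪰ (goal I) (optΣ-best (TD s ⁻)) (optΣ-best (TP s)) ⟩
  half (tourCost (dΣ I) (TD s ⁻) +ℚ tourCost (dΣ I) (TP s)) ≡⟨ cong half (tourCost-dΣ-TD⁻+TP s) ⟩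
  half (value (reverseSwap s) +ℚ value s)                 ∼⟨ half-+-mono-⪰ (goal I) (wor-worst (reverseSwap s)) (reflexive value-s≡opt) ⟩
  half (wor +ℚ opt)                                       ∎
  where
  open Preorder (⪰-preorder (goal I)) using (reflexive)
  open PreorderReasoning (⪰-preorder (goal I))
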